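{- Let $q_2>q_1>2$ be odd integers. Then for every integer $n\ge1$, $f_{2,q_1}(n)\ge f_{2,q_2}(n)$.
   Context: $\mathbb{N}$ denotes the set of nonnegative integers. For an odd integer $q>2$, $f_{2,q}(n)$ denotes the number of different expressions of the positive integer $n$ as a sum of distinct terms taken from $\{2^{\alpha}q^{\beta}:\alpha,\beta\in\mathbb{N}\}$ (i.e. the number of finite subsets of this set whose elements sum to $n$). -}

module Defs where

open import Data.Nat using (ℕ; zero; suc; _+_; _*_; _^_; _≤_; _<_)
open import Data.Nat.Properties using (_≟_)
open import Data.List using (List; []; _∷_; map; filter; length; upTo; concatMap; _++_)
open import Data.Nat.ListAction using (sum)
open import Data.List.Relation.Unary.Any using (Any; any?)
open import Data.Product using (_×_; _,_; proj₁; proj₂)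
open import Relation.Binary.PropositionalEquality using (_≡_)
open import Relation.Nullary using (Dec)

pairsBelow : ℕ → List (ℕ × ℕ)
pairsBelow k = concatMap (λ a → map (λ b → (a , b)) (upTo k)) (upTo k)

-- m is of the form 2^α q^β with α , β ≤ m.  For m ≥ 1 this bound loses
-- nothing (2^α ≤ m forces α < m, and q^β ≤ m with q > 1 forces β < m).
IsTerm : ℕ → ℕ → Set
IsTerm q m = Any (λ ab → 2 ^ proj₁ ab * q ^ proj₂ ab ≡ m) (pairsBelow (suc m))

isTerm? : (q m : ℕ) → Dec (IsTerm q m)
isTerm? q m = any? (λ ab → 2 ^ proj₁ ab * q ^ proj₂ ab ≟ m) (pairsBelow (suc m))

termsUpTo : ℕ → ℕ → List ℕ
termsUpTo q n = filter (isTerm? q) (map suc (upTo n))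

-- All sub-lists (= subsets, for a duplicate-free list).
subsets : {A : Set} → List A → List (List A)
subsets [] = [] ∷ []
subsets (x ∷ xs) = subsets xs ++ map (x ∷_) (subsets xs)

-- f_{2,q}(n): number of finite subsets of {2^α q^β} whose elements sum to n.
-- Any such subset consists of terms ≤ n, so it is a subset of termsUpTo q n.
f2 : ℕ → ℕ → ℕ
f2 q n = length (filter (λ s → sum s ≟ n) (subsets (termsUpTo q n)))

Odd : ℕ → Set
Odd m = Data.Product.Σ ℕ (λ k → m ≡ suc (2 * k))

{-# OPTIONS --safe #-}
module Submission where

-- Every term 2^α q^β is a power of two (β = 0) or q times a term (β ≥ 1), and the two cases are
-- disjoint because q is odd. So a set of terms with sum n splits into a set of powers of two and
-- q·S for a set S of terms with q ΣS ≤ n; conversely every such S is completed in exactly one way,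
-- by the binary expansion of n − q ΣS. Hence f_{2,q}(n) = F_q(⌊n/q⌋), where F_q(m) counts the sets
-- of terms with sum at most m. As F_q(m+1) = F_q(m) + f_{2,q}(m+1) = F_q(m) + F_q(⌊(m+1)/q⌋),
-- strong induction on m gives F_{q₂} ≤ F_{q₁} whenever q₁ ≤ q₂, and F_{q₁} is nondecreasing, so
-- f_{2,q₂}(n) = F_{q₂}(⌊n/q₂⌋) ≤ F_{q₁}(⌊n/q₂⌋) ≤ F_{q₁}(⌊n/q₁⌋) = f_{2,q₁}(n).

open import Defs
open import Data.Nat using (ℕ; _≤_; _<_; _≥_)
open import Data.Nat.Base
  using (zero; suc; _+_; _*_; _^_; _/_; NonZero; z≤n; s≤s; _≤′_; ≤′-refl; ≤′-step)
open import Data.Nat.Properties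
open import Data.Nat.DivMod using (m*n/n≡m; m/n*n≤m; m/n<m; /-congˡ; /-monoˡ-≤; /-monoʳ-≤)
open import Data.Nat.Divisibility using (_∤_; divides)
open import Data.Nat.Primality using (euclidsLemma; prime[2])
open import Data.Nat.Induction using (<-rec)
open import Data.Nat.ListAction using (sum)
open import Data.List.Base using (List; []; _∷_; _++_; map; filter; length; upTo; applyDownFrom)
open import Data.List.Properties using (filter-++; length-++; filter-accept; filter-reject)
open import Data.List.Membership.Propositional using (_∈_)
open import Data.List.Membership.Propositional.Properties
  using ( ∈-map⁺; ∈-map⁻; ∈-++⁺ˡ; ∈-++⁺ʳ; ∈-++⁻; ∈-filter⁺; ∈-filter⁻; ∈-upTo⁺; ∈-upTo⁻; ∈-concatMap⁺
        ; ∈-applyDownFrom⁺; ∈-applyDownFrom⁻)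
open import Data.List.Membership.Propositional.Properties.WithK using (unique∧set⇒bag)
open import Data.List.Relation.Binary.BagAndSetEquality using (∼bag⇒↭)
open import Data.List.Relation.Binary.Permutation.Propositional as ↭ using (_↭_)
open import Data.List.Relation.Unary.Any as Any using ()
open import Data.List.Relation.Unary.Unique.Propositional using (Unique)
import Data.List.Relation.Unary.Unique.Propositional.Properties as Unique
open import Data.Bool.Base using (true; false)
open import Data.Product using (_×_; _,_; proj₂; ∃; ∃₂)
open import Data.Sum using (_⊎_; inj₁; inj₂; [_,_]′)
open import Function using (_∘_; _⇔_; mk⇔; Equivalence)
open import Relation.Binary.PropositionalEquality
  using (_≡_; _≢_; _≗_; refl; sym; trans; cong; cong₂; module ≡-Reasoning)
open import Relation.Nullary using (Dec; does; yes; no; ¬_; contradiction)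
open import Level using (0ℓ)
open import Relation.Unary using (Pred; Decidable)
import Algebra.Properties.CommutativeSemigroup as CommutativeSemigroupProperties
open CommutativeSemigroupProperties +-commutativeSemigroup
  using (interchange) renaming (x∙yz≈y∙xz to +-left-comm)
open CommutativeSemigroupProperties *-commutativeSemigroup
  using () renaming (x∙yz≈y∙xz to *-left-comm)

open Equivalence using (to; from)

private
  variable
    A B : Set
    b k m n q x : ℕ
    w v : ℕ → ℕ
    xs ys : List ℕ

𝟙 : Dec A → ℕ
𝟙 (yes _) = 1
𝟙 (no _) = 0

𝟙-yes : (a? : Dec A) → A → 𝟙 a? ≡ 1
𝟙-yes (yes _) _ = refl
𝟙-yes (no ¬a) a = contradiction a ¬a

𝟙-no : (a? : Dec A) → ¬ A → 𝟙 a? ≡ 0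
𝟙-no (yes a) ¬a = contradiction a ¬a
𝟙-no (no _) _ = refl

𝟙-cong : (a? : Dec A) (b? : Dec B) → A ⇔ B → 𝟙 a? ≡ 𝟙 b?
𝟙-cong (yes a) b? a⇔b = sym (𝟙-yes b? (to a⇔b a))
𝟙-cong (no ¬a) b? a⇔b = sym (𝟙-no b? (¬a ∘ from a⇔b))

𝟙≤-suc : ∀ s m → 𝟙 (s ≤? suc m) ≡ 𝟙 (s ≤? m) + 𝟙 (s ≟ suc m)
𝟙≤-suc s m with s ≤? m | s ≟ suc m
... | yes s≤m | yes refl = contradiction s≤m 1+n≰n
... | yes s≤m | no _ = 𝟙-yes (s ≤? suc m) (m≤n⇒m≤1+n s≤m)
... | no _ | yes refl = 𝟙-yes (s ≤? suc m) ≤-refl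
... | no s≰m | no s≢1+m = 𝟙-no (s ≤? suc m) ([ s≰m ∘ ≤-pred , s≢1+m ]′ ∘ m≤n⇒m<n∨m≡n)

n<m^n : 1 < m → ∀ n → n < m ^ n
n<m^n 1<m zero = s≤s z≤n
n<m^n {m} 1<m (suc n) = ≤-<-trans (n<m^n 1<m n) (^-monoʳ-< m 1<m (n<1+n n))

>1⇒nonZero : 1 < n → NonZero n
>1⇒nonZero (s≤s _) = _

m*n≤o⇔n≤o/m : ∀ m n o .{{_ : NonZero m}} → m * n ≤ o ⇔ n ≤ o / m
m*n≤o⇔n≤o/m m n o = mk⇔
  (λ m*n≤o → begin
    n              ≡⟨ m*n/n≡m n m ⟨
    n * m / m      ≡⟨ /-congˡ (*-comm n m) ⟩
    m * n / m      ≤⟨ /-monoˡ-≤ m m*n≤o ⟩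
    o / m          ∎)
  (λ n≤o/m → begin
    m * n          ≤⟨ *-monoʳ-≤ m n≤o/m ⟩
    m * (o / m)    ≡⟨ *-comm m (o / m) ⟩
    o / m * m      ≤⟨ m/n*n≤m o m ⟩
    o              ∎)
  where open ≤-Reasoning

Odd⇒2∤ : Odd m → 2 ∤ m
Odd⇒2∤ (c , refl) (divides d 1+2c≡d*2) = even≢odd d c (trans (*-comm 2 d) (sym 1+2c≡d*2))

m*n≢2^o : 2 ∤ m → 1 < m → ∀ n o → m * n ≢ 2 ^ o
m*n≢2^o _ 1<m n zero m*n≡1 = >⇒≢ 1<m (m*n≡1⇒m≡1 _ n m*n≡1)
m*n≢2^o {m} 2∤m 1<m n (suc o) m*n≡2^[1+o]
  with euclidsLemma m n prime[2] (divides (2 ^ o) (trans m*n≡2^[1+o] (*-comm 2 (2 ^ o))))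
... | inj₁ 2∣m = 2∤m 2∣m
... | inj₂ (divides n/2 refl) = m*n≢2^o 2∤m 1<m n/2 o (*-cancelˡ-≡ _ _ 2 (begin
  2 * (m * n/2)   ≡⟨ *-left-comm 2 m n/2 ⟩
  m * (2 * n/2)   ≡⟨ cong (m *_) (*-comm 2 n/2) ⟩
  m * (n/2 * 2)   ≡⟨ m*n≡2^[1+o] ⟩
  2 * 2 ^ o       ∎))
  where open ≡-Reasoning

-- sumOverSubsets w xs = Σ_{S ⊆ xs} w (ΣS), with S ranging over the sub-lists of xs.
sumOverSubsets : (ℕ → ℕ) → List ℕ → ℕ
sumOverSubsets w [] = w 0
sumOverSubsets w (x ∷ xs) = sumOverSubsets w xs + sumOverSubsets (λ s → w (x + s)) xs

length-filter-map : {P : Pred B 0ℓ} (P? : Decidable P) (f : A → B) (as : List A) →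
  length (filter P? (map f as)) ≡ length (filter (P? ∘ f) as)
length-filter-map P? f [] = refl
length-filter-map P? f (a ∷ as) with does (P? (f a))
... | false = length-filter-map P? f as
... | true = cong suc (length-filter-map P? f as)

length-filter-subsets : {P : Pred ℕ 0ℓ} (P? : Decidable P) (xs : List ℕ) →
  length (filter (P? ∘ sum) (subsets xs)) ≡ sumOverSubsets (𝟙 ∘ P?) xs
length-filter-subsets P? [] with P? 0
... | yes _ = refl
... | no _ = refl
length-filter-subsets P? (x ∷ xs) = begin
  length (filter (P? ∘ sum) (subsets xs ++ map (x ∷_) (subsets xs)))
    ≡⟨ cong length (filter-++ (P? ∘ sum) (subsets xs) _) ⟩
  length (filter (P? ∘ sum) (subsets xs) ++ filter (P? ∘ sum) (map (x ∷_) (subsets xs)))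
    ≡⟨ length-++ (filter (P? ∘ sum) (subsets xs)) ⟩
  length (filter (P? ∘ sum) (subsets xs)) + length (filter (P? ∘ sum) (map (x ∷_) (subsets xs)))
    ≡⟨ cong (_ +_) (length-filter-map (P? ∘ sum) (x ∷_) (subsets xs)) ⟩
  length (filter (P? ∘ sum) (subsets xs)) + length (filter (P? ∘ (x +_) ∘ sum) (subsets xs))
    ≡⟨ cong₂ _+_ (length-filter-subsets P? xs) (length-filter-subsets (P? ∘ (x +_)) xs) ⟩
  sumOverSubsets (𝟙 ∘ P?) (x ∷ xs) ∎
  where open ≡-Reasoning

sumOverSubsets-cong : v ≗ w → ∀ xs → sumOverSubsets v xs ≡ sumOverSubsets w xs
sumOverSubsets-cong v≗w [] = v≗w 0
sumOverSubsets-cong v≗w (x ∷ xs) =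
  cong₂ _+_ (sumOverSubsets-cong v≗w xs) (sumOverSubsets-cong (v≗w ∘ (x +_)) xs)

sumOverSubsets-+ : ∀ v w xs →
  sumOverSubsets (λ s → v s + w s) xs ≡ sumOverSubsets v xs + sumOverSubsets w xs
sumOverSubsets-+ v w [] = refl
sumOverSubsets-+ v w (x ∷ xs) = trans
  (cong₂ _+_ (sumOverSubsets-+ v w xs) (sumOverSubsets-+ (v ∘ (x +_)) (w ∘ (x +_)) xs))
  (interchange (sumOverSubsets v xs) (sumOverSubsets w xs) _ _)

sumOverSubsets-vanishes : ∀ xs → (∀ s → s ≤ sum xs → w s ≡ 0) → sumOverSubsets w xs ≡ 0
sumOverSubsets-vanishes [] w≡0 = w≡0 0 z≤n
sumOverSubsets-vanishes (x ∷ xs) w≡0 = cong₂ _+_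
  (sumOverSubsets-vanishes xs (λ s s≤ → w≡0 s (≤-trans s≤ (m≤n+m _ x))))
  (sumOverSubsets-vanishes xs (λ s s≤ → w≡0 (x + s) (+-monoʳ-≤ x s≤)))

sumOverSubsets-++ : ∀ w xs ys → sumOverSubsets w (xs ++ ys) ≡
  sumOverSubsets (λ a → sumOverSubsets (λ s → w (a + s)) ys) xs
sumOverSubsets-++ w [] ys = refl
sumOverSubsets-++ w (x ∷ xs) ys = cong₂ _+_ (sumOverSubsets-++ w xs ys) (begin
  sumOverSubsets (λ s → w (x + s)) (xs ++ ys)
    ≡⟨ sumOverSubsets-++ (λ s → w (x + s)) xs ys ⟩
  sumOverSubsets (λ a → sumOverSubsets (λ s → w (x + (a + s))) ys) xs
    ≡⟨ sumOverSubsets-cong (λ a → sumOverSubsets-cong (λ s → cong w (sym (+-assoc x a s))) ys) xs ⟩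
  sumOverSubsets (λ a → sumOverSubsets (λ s → w (x + a + s)) ys) xs ∎)
  where open ≡-Reasoning

sumOverSubsets-map-* : ∀ c w xs →
  sumOverSubsets w (map (c *_) xs) ≡ sumOverSubsets (λ s → w (c * s)) xs
sumOverSubsets-map-* c w [] = cong w (sym (*-zeroʳ c))
sumOverSubsets-map-* c w (x ∷ xs) = cong₂ _+_ (sumOverSubsets-map-* c w xs) (trans
  (sumOverSubsets-map-* c (λ s → w (c * x + s)) xs)
  (sumOverSubsets-cong (λ s → cong w (sym (*-distribˡ-+ c x s))) xs))

sumOverSubsets-↭ : ∀ w → xs ↭ ys → sumOverSubsets w xs ≡ sumOverSubsets w ys
sumOverSubsets-↭ w ↭.refl = refl
sumOverSubsets-↭ w (↭.prep x p) = cong₂ _+_ (sumOverSubsets-↭ w p) (sumOverSubsets-↭ _ p)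
sumOverSubsets-↭ w (↭.trans p q) = trans (sumOverSubsets-↭ w p) (sumOverSubsets-↭ w q)
sumOverSubsets-↭ w (↭.swap {xs} x y p) = trans (interchange (sumOverSubsets w xs) _ _ _) (cong₂ _+_
  (cong₂ _+_ (sumOverSubsets-↭ w p) (sumOverSubsets-↭ _ p))
  (cong₂ _+_ (sumOverSubsets-↭ _ p) (trans
    (sumOverSubsets-cong (λ s → cong w (+-left-comm x y s)) xs)
    (sumOverSubsets-↭ _ p))))

VanishesAbove : ℕ → (ℕ → ℕ) → Set
VanishesAbove b w = ∀ s → b < s → w s ≡ 0

sumOverSubsets-filter-≤ : VanishesAbove b w → ∀ xs →
  sumOverSubsets w xs ≡ sumOverSubsets w (filter (_≤? b) xs)
sumOverSubsets-filter-≤ w-vanishes [] = refl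
sumOverSubsets-filter-≤ {b} {w} w-vanishes (x ∷ xs) with x ≤? b
... | yes x≤b = trans
  (cong₂ _+_ (sumOverSubsets-filter-≤ w-vanishes xs)
    (sumOverSubsets-filter-≤ (λ s b<s → w-vanishes (x + s) (<-≤-trans b<s (m≤n+m s x))) xs))
  (cong (sumOverSubsets w) (sym (filter-accept (_≤? b) x≤b)))
... | no x≰b = trans
  (cong₂ _+_ (sumOverSubsets-filter-≤ w-vanishes xs)
    (sumOverSubsets-vanishes xs (λ s _ → w-vanishes (x + s) (<-≤-trans (≰⇒> x≰b) (m≤m+n x s)))))
  (trans (+-identityʳ _) (cong (sumOverSubsets w) (sym (filter-reject (_≤? b) x≰b))))

sumOverSubsets-agreeUpTo : VanishesAbove b w → Unique xs → Unique ys →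
  (∀ {x} → x ≤ b → x ∈ xs ⇔ x ∈ ys) → sumOverSubsets w xs ≡ sumOverSubsets w ys
sumOverSubsets-agreeUpTo {b} {w} {xs} {ys} w-vanishes xs! ys! xs≈ys = begin
  sumOverSubsets w xs                   ≡⟨ sumOverSubsets-filter-≤ w-vanishes xs ⟩
  sumOverSubsets w (filter (_≤? b) xs)  ≡⟨ sumOverSubsets-↭ w filtered-↭ ⟩
  sumOverSubsets w (filter (_≤? b) ys)  ≡⟨ sumOverSubsets-filter-≤ w-vanishes ys ⟨
  sumOverSubsets w ys                   ∎
  where
  open ≡-Reasoning
  restrict : ∀ {us vs} → (∀ {x} → x ≤ b → x ∈ us → x ∈ vs) →
             ∀ {x} → x ∈ filter (_≤? b) us → x ∈ filter (_≤? b) vs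
  restrict us⊆vs x∈ with ∈-filter⁻ (_≤? b) x∈
  ... | x∈us , x≤b = ∈-filter⁺ (_≤? b) (us⊆vs x≤b x∈us) x≤b
  filtered-↭ : filter (_≤? b) xs ↭ filter (_≤? b) ys
  filtered-↭ = ∼bag⇒↭ (unique∧set⇒bag (Unique.filter⁺ (_≤? b) xs!) (Unique.filter⁺ (_≤? b) ys!)
    (mk⇔ (restrict (to ∘ xs≈ys)) (restrict (from ∘ xs≈ys))))

powersOfTwo : ℕ → List ℕ
powersOfTwo = applyDownFrom (2 ^_)

powersOfTwo-unique : ∀ k → Unique (powersOfTwo k)
powersOfTwo-unique k =
  Unique.applyDownFrom⁺₁ (2 ^_) k (λ j<i _ → >⇒≢ (^-monoʳ-< 2 (s≤s (s≤s z≤n)) j<i))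

1+sum-powersOfTwo : ∀ k → 1 + sum (powersOfTwo k) ≡ 2 ^ k
1+sum-powersOfTwo zero = refl
1+sum-powersOfTwo (suc k) = begin
  1 + (2 ^ k + sum (powersOfTwo k))  ≡⟨ +-suc (2 ^ k) _ ⟨
  2 ^ k + (1 + sum (powersOfTwo k))  ≡⟨ cong (2 ^ k +_) (1+sum-powersOfTwo k) ⟩
  2 ^ k + 2 ^ k                      ≡⟨ cong (2 ^ k +_) (+-identityʳ (2 ^ k)) ⟨
  2 ^ suc k                          ∎
  where open ≡-Reasoning

-- Binary expansion: each t with m ≤ t < m + 2 ^ k is m plus exactly one subset sum of powersOfTwo k.
sumOverSubsets-powersOfTwo : ∀ k m n → n < m + 2 ^ k →
  sumOverSubsets (λ s → 𝟙 (m + s ≟ n)) (powersOfTwo k) ≡ 𝟙 (m ≤? n)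
sumOverSubsets-powersOfTwo zero m n n<m+1 = 𝟙-cong (m + 0 ≟ n) (m ≤? n) (mk⇔
  (λ m+0≡n → ≤-reflexive (trans (sym (+-identityʳ m)) m+0≡n))
  (λ m≤n → trans (+-identityʳ m) (≤-antisym m≤n n≤m)))
  where
  n≤m : n ≤ m
  n≤m = ≤-pred (<-≤-trans n<m+1 (≤-reflexive (+-comm m 1)))
sumOverSubsets-powersOfTwo (suc k) m n n<m+2^[1+k] with n <? m + 2 ^ k
... | yes n<m+2^k =
  trans (cong₂ _+_ (sumOverSubsets-powersOfTwo k m n n<m+2^k) with-2^k-vanishes) (+-identityʳ _)
  where
  with-2^k-vanishes : sumOverSubsets (λ s → 𝟙 (m + (2 ^ k + s) ≟ n)) (powersOfTwo k) ≡ 0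
  with-2^k-vanishes = sumOverSubsets-vanishes (powersOfTwo k) λ s _ →
    𝟙-no (m + (2 ^ k + s) ≟ n) (>⇒≢ (<-≤-trans n<m+2^k (+-monoʳ-≤ m (m≤m+n (2 ^ k) s))))
... | no n≮m+2^k = begin
  sumOverSubsets (λ s → 𝟙 (m + s ≟ n)) P + sumOverSubsets (λ s → 𝟙 (m + (2 ^ k + s) ≟ n)) P
    ≡⟨ cong₂ _+_ without-2^k-vanishes (sumOverSubsets-cong reassociate P) ⟩
  sumOverSubsets (λ s → 𝟙 (m + 2 ^ k + s ≟ n)) P
    ≡⟨ sumOverSubsets-powersOfTwo k (m + 2 ^ k) n n<m+2^k+2^k ⟩
  𝟙 (m + 2 ^ k ≤? n)
    ≡⟨ 𝟙-yes _ m+2^k≤n ⟩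
  1
    ≡⟨ 𝟙-yes _ (≤-trans (m≤m+n m (2 ^ k)) m+2^k≤n) ⟨
  𝟙 (m ≤? n) ∎
  where
  open ≡-Reasoning
  P : List ℕ
  P = powersOfTwo k
  m+2^k≤n : m + 2 ^ k ≤ n
  m+2^k≤n = ≮⇒≥ n≮m+2^k
  subsetSum<2^k : ∀ {s} → s ≤ sum P → s < 2 ^ k
  subsetSum<2^k s≤ = <-≤-trans (s≤s s≤) (≤-reflexive (1+sum-powersOfTwo k))
  without-2^k-vanishes : sumOverSubsets (λ s → 𝟙 (m + s ≟ n)) P ≡ 0
  without-2^k-vanishes = sumOverSubsets-vanishes P λ s s≤ →
    𝟙-no (m + s ≟ n) (<⇒≢ (<-≤-trans (+-monoʳ-< m (subsetSum<2^k s≤)) m+2^k≤n))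
  reassociate : (λ s → 𝟙 (m + (2 ^ k + s) ≟ n)) ≗ (λ s → 𝟙 (m + 2 ^ k + s ≟ n))
  reassociate s = cong (λ t → 𝟙 (t ≟ n)) (sym (+-assoc m (2 ^ k) s))
  n<m+2^k+2^k : n < m + 2 ^ k + 2 ^ k
  n<m+2^k+2^k = <-≤-trans n<m+2^[1+k] (≤-reflexive (trans
    (cong (λ t → m + (2 ^ k + t)) (+-identityʳ (2 ^ k))) (sym (+-assoc m (2 ^ k) (2 ^ k)))))

Term : ℕ → ℕ → Set
Term q x = ∃₂ λ a b → 2 ^ a * q ^ b ≡ x

Term-2^ : ∀ a → Term q (2 ^ a)
Term-2^ a = a , 0 , *-identityʳ (2 ^ a)

Term-* : Term q x → Term q (q * x)
Term-* {q} (a , b , refl) = a , suc b , *-left-comm (2 ^ a) q (q ^ b)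

Term-split : Term q x → (∃ λ a → 2 ^ a ≡ x) ⊎ (∃ λ t → Term q t × q * t ≡ x)
Term-split (a , zero , 2^a*1≡x) = inj₁ (a , trans (sym (*-identityʳ (2 ^ a))) 2^a*1≡x)
Term-split {q} (a , suc b , 2^a*q^[1+b]≡x) =
  inj₂ (2 ^ a * q ^ b , (a , b , refl) , trans (sym (*-left-comm (2 ^ a) q (q ^ b))) 2^a*q^[1+b]≡x)

IsTerm⇒Term : IsTerm q x → Term q x
IsTerm⇒Term isTerm with Any.satisfied isTerm
... | (a , b) , 2^a*q^b≡x = a , b , 2^a*q^b≡x

termsUpTo-unique : ∀ q n → Unique (termsUpTo q n)
termsUpTo-unique q n = Unique.filter⁺ (isTerm? q) (Unique.map⁺ suc-injective (Unique.upTo⁺ n))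

∈-termsUpTo⁻ : ∀ q n → x ∈ termsUpTo q n → x ≤ n × Term q x
∈-termsUpTo⁻ q n x∈ with ∈-filter⁻ (isTerm? q) {xs = map suc (upTo n)} x∈
... | x∈map-suc , isTerm with ∈-map⁻ suc x∈map-suc
... | _ , y∈upTo , refl = ∈-upTo⁻ y∈upTo , IsTerm⇒Term isTerm

∈-pairsBelow⁺ : ∀ {a b} → a < k → b < k → (a , b) ∈ pairsBelow k
∈-pairsBelow⁺ {k} {a} a<k b<k = ∈-concatMap⁺ (λ a → map (a ,_) (upTo k))
  (Any.map (λ { refl → ∈-map⁺ (a ,_) (∈-upTo⁺ b<k) }) (∈-upTo⁺ a<k))

F2 : ℕ → ℕ → ℕ
F2 q m = sumOverSubsets (λ s → 𝟙 (s ≤? m)) (termsUpTo q m)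

module _ {q : ℕ} (1<q : 1 < q) where

  private instance
    q≢0 : NonZero q
    q≢0 = >1⇒nonZero 1<q

  Term-positive : Term q x → 0 < x
  Term-positive (a , b , refl) = *-mono-≤ (m^n>0 2 a) (m^n>0 q b)

  Term⇒IsTerm : Term q x → IsTerm q x
  Term⇒IsTerm {x} (a , b , refl) = Any.map (λ { refl → refl }) (∈-pairsBelow⁺ (s≤s a≤x) (s≤s b≤x))
    where
    a≤x : a ≤ x
    a≤x = ≤-trans (<⇒≤ (n<m^n (s≤s (s≤s z≤n)) a)) (m≤m*n (2 ^ a) (q ^ b) {{m^n≢0 q b}})
    b≤x : b ≤ x
    b≤x = ≤-trans (<⇒≤ (n<m^n 1<q b)) (m≤n*m (q ^ b) (2 ^ a) {{m^n≢0 2 a}})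

  ∈-termsUpTo⁺ : x ≤ n → Term q x → x ∈ termsUpTo q n
  ∈-termsUpTo⁺ {zero} _ term = contradiction (Term-positive term) (<-irrefl refl)
  ∈-termsUpTo⁺ {suc y} y<n term = ∈-filter⁺ (isTerm? q) (∈-map⁺ suc (∈-upTo⁺ y<n)) (Term⇒IsTerm term)

  F2-suc : ∀ m → F2 q (suc m) ≡ F2 q m + f2 q (suc m)
  F2-suc m = begin
    F2 q (suc m)
      ≡⟨ sumOverSubsets-cong (λ s → 𝟙≤-suc s m) T ⟩
    sumOverSubsets (λ s → 𝟙 (s ≤? m) + 𝟙 (s ≟ suc m)) T
      ≡⟨ sumOverSubsets-+ _ _ T ⟩
    sumOverSubsets (λ s → 𝟙 (s ≤? m)) T + sumOverSubsets (λ s → 𝟙 (s ≟ suc m)) T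
      ≡⟨ cong₂ _+_
           (sumOverSubsets-agreeUpTo ≤m-vanishes (termsUpTo-unique q (suc m)) (termsUpTo-unique q m) agree)
           (sym (length-filter-subsets (_≟ suc m) T)) ⟩
    F2 q m + f2 q (suc m) ∎
    where
    open ≡-Reasoning
    T : List ℕ
    T = termsUpTo q (suc m)
    ≤m-vanishes : VanishesAbove m (λ s → 𝟙 (s ≤? m))
    ≤m-vanishes s m<s = 𝟙-no (s ≤? m) (<⇒≱ m<s)
    agree : ∀ {x} → x ≤ m → x ∈ termsUpTo q (suc m) ⇔ x ∈ termsUpTo q m
    agree x≤m = mk⇔ (∈-termsUpTo⁺ x≤m ∘ proj₂ ∘ ∈-termsUpTo⁻ q (suc m))
                    (∈-termsUpTo⁺ (m≤n⇒m≤1+n x≤m) ∘ proj₂ ∘ ∈-termsUpTo⁻ q m)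

  F2-mono : m ≤ n → F2 q m ≤ F2 q n
  F2-mono = mono′ ∘ ≤⇒≤′
    where
    mono′ : m ≤′ n → F2 q m ≤ F2 q n
    mono′ ≤′-refl = ≤-refl
    mono′ (≤′-step {n} m≤′n) =
      ≤-trans (mono′ m≤′n) (≤-trans (m≤m+n (F2 q n) (f2 q (suc n))) (≤-reflexive (sym (F2-suc n))))

  module _ (2∤q : 2 ∤ q) where

    splitTerms : ℕ → List ℕ
    splitTerms n = map (q *_) (termsUpTo q (n / q)) ++ powersOfTwo n

    splitTerms-unique : ∀ n → Unique (splitTerms n)
    splitTerms-unique n = Unique.++⁺ (Unique.map⁺ (*-cancelˡ-≡ _ _ q) (termsUpTo-unique q (n / q)))
      (powersOfTwo-unique n) disjoint
      where
      disjoint : ∀ {x} → ¬ (x ∈ map (q *_) (termsUpTo q (n / q)) × x ∈ powersOfTwo n)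
      disjoint (x∈q* , x∈2^) with ∈-map⁻ (q *_) x∈q* | ∈-applyDownFrom⁻ (2 ^_) x∈2^
      ... | t , _ , refl | a , _ , q*t≡2^a = m*n≢2^o 2∤q 1<q t a q*t≡2^a

    ∈-splitTerms : x ≤ n → x ∈ termsUpTo q n ⇔ x ∈ splitTerms n
    ∈-splitTerms {x} {n} x≤n =
      mk⇔ (split ∘ Term-split ∘ proj₂ ∘ ∈-termsUpTo⁻ q n) (unsplit ∘ ∈-++⁻ _)
      where
      split : (∃ λ a → 2 ^ a ≡ x) ⊎ (∃ λ t → Term q t × q * t ≡ x) → x ∈ splitTerms n
      split (inj₁ (a , refl)) =
        ∈-++⁺ʳ _ (∈-applyDownFrom⁺ (2 ^_) (<-≤-trans (n<m^n (s≤s (s≤s z≤n)) a) x≤n))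
      split (inj₂ (t , term , refl)) =
        ∈-++⁺ˡ (∈-map⁺ (q *_) (∈-termsUpTo⁺ (to (m*n≤o⇔n≤o/m q t n) x≤n) term))
      unsplit : x ∈ map (q *_) (termsUpTo q (n / q)) ⊎ x ∈ powersOfTwo n → x ∈ termsUpTo q n
      unsplit (inj₁ x∈q*) with ∈-map⁻ (q *_) x∈q*
      ... | t , t∈ , refl = ∈-termsUpTo⁺ x≤n (Term-* (proj₂ (∈-termsUpTo⁻ q (n / q) t∈)))
      unsplit (inj₂ x∈2^) with ∈-applyDownFrom⁻ (2 ^_) x∈2^
      ... | a , _ , refl = ∈-termsUpTo⁺ x≤n (Term-2^ a)

    f2≡F2[/] : ∀ n → f2 q n ≡ F2 q (n / q)
    f2≡F2[/] n = begin
      f2 q n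
        ≡⟨ length-filter-subsets (_≟ n) (termsUpTo q n) ⟩
      sumOverSubsets (λ s → 𝟙 (s ≟ n)) (termsUpTo q n)
        ≡⟨ sumOverSubsets-agreeUpTo (λ s n<s → 𝟙-no (s ≟ n) (>⇒≢ n<s))
             (termsUpTo-unique q n) (splitTerms-unique n) ∈-splitTerms ⟩
      sumOverSubsets (λ s → 𝟙 (s ≟ n)) (map (q *_) W ++ powersOfTwo n)
        ≡⟨ sumOverSubsets-++ _ (map (q *_) W) (powersOfTwo n) ⟩
      sumOverSubsets (λ a → sumOverSubsets (λ s → 𝟙 (a + s ≟ n)) (powersOfTwo n)) (map (q *_) W)
        ≡⟨ sumOverSubsets-cong (λ a → sumOverSubsets-powersOfTwo n a n
             (<-≤-trans (n<m^n (s≤s (s≤s z≤n)) n) (m≤n+m _ a))) (map (q *_) W) ⟩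
      sumOverSubsets (λ a → 𝟙 (a ≤? n)) (map (q *_) W)
        ≡⟨ sumOverSubsets-map-* q _ W ⟩
      sumOverSubsets (λ t → 𝟙 (q * t ≤? n)) W
        ≡⟨ sumOverSubsets-cong (λ t → 𝟙-cong (q * t ≤? n) (t ≤? n / q) (m*n≤o⇔n≤o/m q t n)) W ⟩
      F2 q (n / q) ∎
      where
      open ≡-Reasoning
      W : List ℕ
      W = termsUpTo q (n / q)

    F2-recurrence : ∀ m → F2 q (suc m) ≡ F2 q m + F2 q (suc m / q)
    F2-recurrence m = trans (F2-suc m) (cong (F2 q m +_) (f2≡F2[/] (suc m)))

F2-antitone : ∀ {q₁ q₂} → 2 ∤ q₁ → 2 ∤ q₂ → 1 < q₁ → q₁ ≤ q₂ → ∀ m → F2 q₂ m ≤ F2 q₁ m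
F2-antitone {q₁} {q₂} 2∤q₁ 2∤q₂ 1<q₁ q₁≤q₂ = <-rec _ step
  where
  1<q₂ : 1 < q₂
  1<q₂ = <-≤-trans 1<q₁ q₁≤q₂
  instance
    q₁≢0 : NonZero q₁
    q₁≢0 = >1⇒nonZero 1<q₁
    q₂≢0 : NonZero q₂
    q₂≢0 = >1⇒nonZero 1<q₂
  step : ∀ m → (∀ {j} → j < m → F2 q₂ j ≤ F2 q₁ j) → F2 q₂ m ≤ F2 q₁ m
  step zero _ = ≤-refl
  step (suc m) ih = begin
    F2 q₂ (suc m)                  ≡⟨ F2-recurrence 1<q₂ 2∤q₂ m ⟩
    F2 q₂ m + F2 q₂ (suc m / q₂)   ≤⟨ +-mono-≤ (ih ≤-refl) (ih (m/n<m (suc m) q₂ 1<q₂)) ⟩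
    F2 q₁ m + F2 q₁ (suc m / q₂)   ≤⟨ +-monoʳ-≤ (F2 q₁ m) (F2-mono 1<q₁ (/-monoʳ-≤ (suc m) q₁≤q₂)) ⟩
    F2 q₁ m + F2 q₁ (suc m / q₁)   ≡⟨ F2-recurrence 1<q₁ 2∤q₁ m ⟨
    F2 q₁ (suc m)                  ∎
    where open ≤-Reasoning

corollary7 : (q₁ q₂ : ℕ) → Odd q₁ → Odd q₂ → 2 < q₁ → q₁ < q₂ →
    (n : ℕ) → 1 ≤ n → f2 q₁ n ≥ f2 q₂ n
corollary7 q₁ q₂ odd₁ odd₂ 2<q₁ q₁<q₂ n _ = begin
  f2 q₂ n         ≡⟨ f2≡F2[/] 1<q₂ (Odd⇒2∤ odd₂) n ⟩
  F2 q₂ (n / q₂)  ≤⟨ F2-antitone (Odd⇒2∤ odd₁) (Odd⇒2∤ odd₂) 1<q₁ q₁≤q₂ (n / q₂) ⟩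
  F2 q₁ (n / q₂)  ≤⟨ F2-mono 1<q₁ (/-monoʳ-≤ n q₁≤q₂) ⟩
  F2 q₁ (n / q₁)  ≡⟨ f2≡F2[/] 1<q₁ (Odd⇒2∤ odd₁) n ⟨
  f2 q₁ n         ∎
  where
  open ≤-Reasoning
  q₁≤q₂ : q₁ ≤ q₂
  q₁≤q₂ = <⇒≤ q₁<q₂
  1<q₁ : 1 < q₁
  1<q₁ = <⇒≤ 2<q₁
  1<q₂ : 1 < q₂
  1<q₂ = <-trans 1<q₁ q₁<q₂
  instance
    q₁≢0 : NonZero q₁
    q₁≢0 = >1⇒nonZero 1<q₁
    q₂≢0 : NonZero q₂
    q₂≢0 = >1⇒nonZero 1<q₂
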